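{- For any graph $G$, the size of its LC equivalence class is bounded above by the size of its QASST equivalence class: $|\mathcal{O}(G)|\leq\Phi(G)$.
   Context: Local complement $c_v(G)$: replace the subgraph induced on the neighbourhood of $v$ by its complement, leaving all other edges unchanged; $\mathcal{O}(G)$ is the set of labeled graphs on the vertex set of $G$ locally equivalent to $G$. Split decomposition: the strong splits (bipartitions with complete bipartite crossing edges between the vertices adjacent across, not crossed by any other split) of $G$ form the edges of the strong split tree $SST(G)$; collapsing each nontrivial strong split into a pair of adjacent split-nodes yields quotient graphs (one per internal tree node) containing leaf-nodes (vertices of $G$) and split-nodes. Two graphs on the same vertex set are QASST equivalent if they have the same strong split tree and each quotient graph of one is locally equivalent to the corresponding quotient graph of the other. $\Phi(G)$ denotes the number of graphs QASST equivalent to $G$. -}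

module Defs where

open import Data.Bool using (Bool; true; false; not; _∧_; _∨_; if_then_else_)
open import Data.Nat using (ℕ; zero; suc; _≤_)
open import Data.Fin using (Fin; zero; suc; _≟_)
open import Data.Product using (Σ; ∃; ∃-syntax; _×_; _,_; proj₁; proj₂)
open import Data.Sum using (_⊎_)
open import Function.Bundles using (_⇔_)
open import Relation.Nullary using (¬_)
open import Relation.Nullary.Decidable using (⌊_⌋)
open import Relation.Binary.PropositionalEquality using (_≡_; _≢_)
open import Relation.Binary.Construct.Closure.ReflexiveTransitive using (Star)

Graph : ℕ → Set
Graph n = Fin n → Fin n → Bool

IsSimple : ∀ {n} → Graph n → Set
IsSimple G = (∀ i j → G i j ≡ G j i) × (∀ i → G i i ≡ false)

_≗G_ : ∀ {n} → Graph n → Graph n → Set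
G ≗G H = ∀ i j → G i j ≡ H i j

lc : ∀ {n} → Fin n → Graph n → Graph n
lc v G i j =
  if G v i ∧ G v j ∧ not ⌊ i ≟ j ⌋ then not (G i j) else G i j

LCStep : ∀ {n} → Graph n → Graph n → Set
LCStep G H = ∃[ v ] (lc v G ≗G H)

LCEq : ∀ {n} → Graph n → Graph n → Set
LCEq = Star LCStep

-- Bipartitions (A , B) of Fin n, encoded by the side indicator
-- s : Fin n → Bool  (A = s⁻¹ true, B = s⁻¹ false).

AtLeastTwo : ∀ {n} → (Fin n → Bool) → Bool → Set
AtLeastTwo s b = ∃[ x ] ∃[ y ] (x ≢ y × s x ≡ b × s y ≡ b)

-- (A , B) is a split of G: |A|,|B| ≥ 2 and the edges between A and B form a
-- complete bipartite graph between A' = {a ∈ A | a has a neighbour in B}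
-- and B' = {b ∈ B | b has a neighbour in A}.
IsSplit : ∀ {n} → Graph n → (Fin n → Bool) → Set
IsSplit G s =
  AtLeastTwo s true × AtLeastTwo s false ×
  (∀ a b → s a ≡ true → s b ≡ false →
     (∃[ b' ] (s b' ≡ false × G a b' ≡ true)) →
     (∃[ a' ] (s a' ≡ true × G a' b ≡ true)) →
     G a b ≡ true)

Cross : ∀ {n} → (Fin n → Bool) → (Fin n → Bool) → Set
Cross s t = ∀ b c → ∃[ x ] (s x ≡ b × t x ≡ c)

IsStrongSplit : ∀ {n} → Graph n → (Fin n → Bool) → Set
IsStrongSplit G s = IsSplit G s × (∀ t → IsSplit G t → ¬ Cross s t)

-- An internal node u of SST(G) is recorded by the partition of the leaf
-- set V = Fin n into the leaf sets of the components of SST(G) − u,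
-- given as a surjection p : Fin n → Fin k (k = degree of u).  Such
-- partitions are exactly those with k ≥ 3 parts, each part being a
-- single leaf or one side of a strong split, and such that every strong
-- split has a side contained in a single part.

Part : ∀ {n k} → (Fin n → Fin k) → Fin k → (Fin n → Bool)
Part p i x = ⌊ p x ≟ i ⌋

IsNode : ∀ {n} → Graph n → (k : ℕ) → (Fin n → Fin k) → Set
IsNode {n} G k p =
  3 ≤ k ×
  (∀ i → ∃[ x ] (p x ≡ i)) ×
  (∀ i → (∀ x y → p x ≡ i → p y ≡ i → x ≡ y) ⊎ IsStrongSplit G (Part p i)) ×
  (∀ s → IsStrongSplit G s →
     ∃[ i ] ((∀ x → s x ≡ true → p x ≡ i) ⊎ (∀ x → s x ≡ false → p x ≡ i)))

anyFin : ∀ {n} → (Fin n → Bool) → Bool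
anyFin {zero}  f = false
anyFin {suc n} f = f zero ∨ anyFin (λ x → f (suc x))

-- quotient graph at the node p: vertices are the parts (leaf-nodes for
-- singleton parts, split-nodes otherwise); two distinct parts are
-- adjacent iff some edge of G joins them.
Quotient : ∀ {n k} → Graph n → (Fin n → Fin k) → Graph k
Quotient G p i j =
  not ⌊ i ≟ j ⌋ ∧ anyFin (λ x → anyFin (λ y → Part p i x ∧ Part p j y ∧ G x y))

QASST : ∀ {n} → Graph n → Graph n → Set
QASST G H =
  (∀ s → IsStrongSplit G s ⇔ IsStrongSplit H s) ×
  (∀ k p → IsNode G k p → LCEq (Quotient G p) (Quotient H p))

-- The two equivalence classes (as sets of graphs on Fin n) and the
-- comparison of cardinalities |X| ≤ |Y| via an injection that respects
-- graph equality.

CardLe : ∀ {n} {P Q : Graph n → Set} → Set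
CardLe {n} {P} {Q} =
  Σ (Σ (Graph n) P → Σ (Graph n) Q) λ f →
    (∀ x y → proj₁ x ≗G proj₁ y → proj₁ (f x) ≗G proj₁ (f y)) ×
    (∀ x y → proj₁ (f x) ≗G proj₁ (f y) → proj₁ x ≗G proj₁ y)

OrbitLeQASST : ∀ {n} → Graph n → Set
OrbitLeQASST G =
  CardLe {P = λ H → IsSimple H × LCEq G H} {Q = λ H → IsSimple H × QASST G H}

{-# OPTIONS --safe #-}
-- Every graph locally equivalent to G is QASST equivalent to G, so inclusion is the required
-- injection.  The edges across a split form a complete bipartite graph A′ × B′, and complementing
-- at a vertex keeps this shape; as local complementation is an involution, splits, strong splits
-- and the nodes of the split tree are therefore invariant.  At a node, complementing G at a vertex
-- v of part i₀ complements the quotient graph at i₀ when v has a neighbour outside i₀: the parts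
-- adjacent to i₀ are then exactly those meeting N(v), N(v) meets each of them in its frontier,
-- and so the edges between two such parts are flipped all together.  When N(v) ⊆ i₀ the quotient
-- graph does not change.

module Submission where

open import Defs
open import Data.Nat as ℕ using (ℕ)
open import Data.Bool using (Bool; T; true; false; not; _∧_; _xor_; if_then_else_)
open import Data.Bool.Properties
  using (∧-comm; ∧-assoc; ∧-zeroʳ; ∧-identityʳ; ∧-conicalˡ; ∧-conicalʳ;
         ∧-distribˡ-xor; ∧-distribʳ-xor; ∨-zeroʳ; not-involutive; ¬-not)
  renaming (_≟_ to _≟ᵇ_)
open import Data.Fin using (Fin; zero; suc; _≟_)
open import Data.Fin.Properties using (any?)
open import Data.Product using (∃-syntax; _×_; _,_; proj₁; proj₂)
open import Data.Sum using (_⊎_; inj₁; inj₂; [_,_]; [_,_]′; map₂)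
open import Function using (_∘_)
open import Function.Bundles using (_⇔_; mk⇔; Equivalence)
open import Function.Properties.Equivalence using () renaming (refl to ⇔-refl; trans to ⇔-trans)
open import Relation.Nullary using (¬_; Dec; yes; no; contradiction)
open import Relation.Nullary.Decidable
  using (⌊_⌋; isYes≗does; dec-true; dec-false; toWitness; ¬?; _×-dec_)
open import Relation.Binary.PropositionalEquality
  using (_≡_; _≢_; refl; sym; trans; cong; cong₂; subst; module ≡-Reasoning)
open import Relation.Binary.Construct.Closure.ReflexiveTransitive using (ε; _◅_; _◅◅_)

private
  variable
    n k : ℕ

true-or-false : ∀ b → b ≡ true ⊎ b ≡ false
true-or-false true  = inj₁ refl
true-or-false false = inj₂ refl

bool-ext : ∀ {a b} → (a ≡ true → b ≡ true) → (b ≡ true → a ≡ true) → a ≡ b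
bool-ext {true}  {true}  _ _ = refl
bool-ext {true}  {false} f _ = sym (f refl)
bool-ext {false} {true}  _ g = g refl
bool-ext {false} {false} _ _ = refl

true≢false : true ≢ false
true≢false ()

not-true : ∀ {b} → not b ≡ true → b ≡ false
not-true {false} _ = refl

if-not≡xor : ∀ c b → (if c then not b else b) ≡ c xor b
if-not≡xor true  b = refl
if-not≡xor false b = refl

if-not-twice : ∀ c b → (if c then not (if c then not b else b) else (if c then not b else b)) ≡ b
if-not-twice true  b = not-involutive b
if-not-twice false b = refl

xor-∧-absorb : ∀ c q → c xor (q ∧ c) ≡ not q ∧ c
xor-∧-absorb true  true  = refl
xor-∧-absorb true  false = refl
xor-∧-absorb false q     = trans (∧-zeroʳ q) (sym (∧-zeroʳ (not q)))

anyFin⁺ : (f : Fin n → Bool) (x : Fin n) → f x ≡ true → anyFin f ≡ true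
anyFin⁺ f zero    fx rewrite fx = refl
anyFin⁺ f (suc x) fx rewrite anyFin⁺ (f ∘ suc) x fx = ∨-zeroʳ (f zero)

anyFin⁻ : (f : Fin n → Bool) → anyFin f ≡ true → ∃[ x ] (f x ≡ true)
anyFin⁻ {ℕ.suc n} f any with f zero in f0
... | true  = zero , f0
... | false with anyFin⁻ (f ∘ suc) any
...   | x , fx = suc x , fx

⌊⌋-true : ∀ {a} {A : Set a} (a? : Dec A) → A → ⌊ a? ⌋ ≡ true
⌊⌋-true a? a = trans (isYes≗does a?) (dec-true a? a)

⌊⌋-false : ∀ {a} {A : Set a} (a? : Dec A) → ¬ A → ⌊ a? ⌋ ≡ false
⌊⌋-false a? ¬a = trans (isYes≗does a?) (dec-false a? ¬a)

⌊⌋-true⁻ : ∀ {a} {A : Set a} (a? : Dec A) → ⌊ a? ⌋ ≡ true → A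
⌊⌋-true⁻ a? e = toWitness {a? = a?} (subst T (sym e) _)

IsSymmetric : Graph n → Set
IsSymmetric G = ∀ x y → G x y ≡ G y x

module _ {G : Graph n} {v : Fin n} where

  lc-outsideˡ : ∀ {x y} → G v x ≡ false → lc v G x y ≡ G x y
  lc-outsideˡ e rewrite e = refl

  lc-outsideʳ : ∀ {x y} → G v y ≡ false → lc v G x y ≡ G x y
  lc-outsideʳ {x} e rewrite e | ∧-zeroʳ (G v x) = refl

  lc-diag : ∀ x → lc v G x x ≡ G x x
  lc-diag x = cong (λ c → if c then not (G x x) else G x x) (begin
    G v x ∧ G v x ∧ not ⌊ x ≟ x ⌋ ≡⟨ cong (λ b → G v x ∧ G v x ∧ not b) (⌊⌋-true (x ≟ x) refl) ⟩
    G v x ∧ G v x ∧ false         ≡⟨ cong (G v x ∧_) (∧-zeroʳ (G v x)) ⟩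
    G v x ∧ false                 ≡⟨ ∧-zeroʳ (G v x) ⟩
    false                         ∎)
    where open ≡-Reasoning

  lc-xor : ∀ {x y} → x ≢ y → lc v G x y ≡ (G v x ∧ G v y) xor G x y
  lc-xor {x} {y} x≢y rewrite ⌊⌋-false (x ≟ y) x≢y | ∧-identityʳ (G v y) =
    if-not≡xor (G v x ∧ G v y) (G x y)

  lc-involutive : G v v ≡ false → lc v (lc v G) ≗G G
  lc-involutive vv x y
    rewrite lc-outsideˡ {x = v} {x} vv | lc-outsideˡ {x = v} {y} vv =
    if-not-twice (G v x ∧ G v y ∧ not ⌊ x ≟ y ⌋) (G x y)

  lc-symmetric : IsSymmetric G → IsSymmetric (lc v G)
  lc-symmetric G-sym x y = by-cases (x ≟ y)
    where
    open ≡-Reasoning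
    by-cases : Dec (x ≡ y) → lc v G x y ≡ lc v G y x
    by-cases (yes refl) = refl
    by-cases (no x≢y)   = begin
      lc v G x y                ≡⟨ lc-xor x≢y ⟩
      (G v x ∧ G v y) xor G x y ≡⟨ cong₂ _xor_ (∧-comm (G v x) (G v y)) (G-sym x y) ⟩
      (G v y ∧ G v x) xor G y x ≡⟨ lc-xor (x≢y ∘ sym) ⟨
      lc v G y x                ∎

  IsSimple-lc : IsSimple G → IsSimple (lc v G)
  IsSimple-lc (G-sym , irrefl) = lc-symmetric G-sym , λ x → trans (lc-diag x) (irrefl x)

IsSimple-resp : {G H : Graph n} → G ≗G H → IsSimple G → IsSimple H
IsSimple-resp G≗H (G-sym , irrefl) =
  (λ x y → trans (sym (G≗H x y)) (trans (G-sym x y) (G≗H y x))) ,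
  (λ x → trans (sym (G≗H x x)) (irrefl x))

IsSimple-LCStep : {G H : Graph n} → IsSimple G → LCStep G H → IsSimple H
IsSimple-LCStep simple (v , lcG≗H) = IsSimple-resp lcG≗H (IsSimple-lc simple)

CompleteAcross : Graph n → (Fin n → Bool) → Set
CompleteAcross G s =
  ∀ a b → s a ≡ true → s b ≡ false →
  (∃[ b′ ] (s b′ ≡ false × G a b′ ≡ true)) →
  (∃[ a′ ] (s a′ ≡ true × G a′ b ≡ true)) →
  G a b ≡ true

record Biclique (G : Graph n) (s : Fin n → Bool) : Set where
  field
    A′ B′ : Fin n → Bool
    cross : ∀ a b → s a ≡ true → s b ≡ false → G a b ≡ A′ a ∧ B′ b

module _ {G : Graph n} {s : Fin n → Bool} where

  sides-distinct : ∀ {a b} → s a ≡ true → s b ≡ false → a ≢ b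
  sides-distinct sa sb refl = true≢false (trans (sym sa) sb)

  biclique-of-completeAcross : CompleteAcross G s → Biclique G s
  biclique-of-completeAcross complete = record { A′ = A′ ; B′ = B′ ; cross = cross }
    where
    A′ B′ : Fin n → Bool
    A′ a = anyFin λ b → not (s b) ∧ G a b
    B′ b = anyFin λ a → s a ∧ G a b
    cross : ∀ a b → s a ≡ true → s b ≡ false → G a b ≡ A′ a ∧ B′ b
    cross a b sa sb = bool-ext to from
      where
      to : G a b ≡ true → A′ a ∧ B′ b ≡ true
      to ab = cong₂ _∧_ (anyFin⁺ _ b (cong₂ _∧_ (cong not sb) ab)) (anyFin⁺ _ a (cong₂ _∧_ sa ab))
      from : A′ a ∧ B′ b ≡ true → G a b ≡ true
      from e with anyFin⁻ _ (∧-conicalˡ _ _ e) | anyFin⁻ _ (∧-conicalʳ _ _ e)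
      ... | b′ , e₁ | a′ , e₂ =
        complete a b sa sb (b′ , not-true (∧-conicalˡ _ _ e₁) , ∧-conicalʳ _ _ e₁)
                           (a′ , ∧-conicalˡ _ _ e₂ , ∧-conicalʳ _ _ e₂)

  module _ (bc : Biclique G s) where
    open Biclique bc

    completeAcross-of-biclique : CompleteAcross G s
    completeAcross-of-biclique a b sa sb (b′ , sb′ , ab′) (a′ , sa′ , a′b) =
      trans (cross a b sa sb)
            (cong₂ _∧_ (∧-conicalˡ (A′ a) (B′ b′) (trans (sym (cross a b′ sa sb′)) ab′))
                       (∧-conicalʳ (A′ a′) (B′ b) (trans (sym (cross a′ b sa′ sb)) a′b)))

    B′-neighbourhood : ∀ {v b₀} → s v ≡ true → s b₀ ≡ false → G v b₀ ≡ true →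
                       ∀ b → s b ≡ false → G v b ≡ B′ b
    B′-neighbourhood {v} {b₀} sv sb₀ vb₀ b sb =
      trans (cross v b sv sb) (cong (_∧ B′ b) (∧-conicalˡ _ _ (trans (sym (cross v b₀ sv sb₀)) vb₀)))

    A′-neighbourhood : ∀ {v a₀} → s v ≡ false → s a₀ ≡ true → G a₀ v ≡ true →
                       ∀ a → s a ≡ true → G a v ≡ A′ a
    A′-neighbourhood {v} {a₀} sv sa₀ a₀v a sa =
      trans (cross a v sa sv)
            (trans (cong (A′ a ∧_) (∧-conicalʳ _ _ (trans (sym (cross a₀ v sa₀ sv)) a₀v)))
                   (∧-identityʳ (A′ a)))

    -- If v ∈ A′ then N(v) ∩ B = B′, so complementing at v flips exactly the edges between
    -- N(v) ∩ A and B′: the frontier A′ becomes A′ ⊕ N(v).  If v ∉ A′, no edge across changes.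
    -- Symmetrically for v ∈ B.
    biclique-lc : IsSymmetric G → (v : Fin n) → Biclique (lc v G) s
    biclique-lc G-sym v with true-or-false (s v)
    ... | inj₁ sv = record { A′ = λ a → (G v a ∧ A′ v) xor A′ a ; B′ = B′ ; cross = cross-v∈A }
      where
      cross-v∈A : ∀ a b → s a ≡ true → s b ≡ false →
                  lc v G a b ≡ ((G v a ∧ A′ v) xor A′ a) ∧ B′ b
      cross-v∈A a b sa sb = begin
        lc v G a b
          ≡⟨ lc-xor {G = G} (sides-distinct sa sb) ⟩
        (G v a ∧ G v b) xor G a b
          ≡⟨ cong₂ (λ x y → (G v a ∧ x) xor y) (cross v b sv sb) (cross a b sa sb) ⟩
        (G v a ∧ (A′ v ∧ B′ b)) xor (A′ a ∧ B′ b)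
          ≡⟨ cong (_xor (A′ a ∧ B′ b)) (∧-assoc (G v a) (A′ v) (B′ b)) ⟨
        ((G v a ∧ A′ v) ∧ B′ b) xor (A′ a ∧ B′ b)
          ≡⟨ ∧-distribʳ-xor (B′ b) (G v a ∧ A′ v) (A′ a) ⟨
        ((G v a ∧ A′ v) xor A′ a) ∧ B′ b
          ∎
        where open ≡-Reasoning
    ... | inj₂ sv = record { A′ = A′ ; B′ = λ b → (B′ v ∧ G v b) xor B′ b ; cross = cross-v∈B }
      where
      cross-v∈B : ∀ a b → s a ≡ true → s b ≡ false →
                  lc v G a b ≡ A′ a ∧ ((B′ v ∧ G v b) xor B′ b)
      cross-v∈B a b sa sb = begin
        lc v G a b
          ≡⟨ lc-xor {G = G} (sides-distinct sa sb) ⟩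
        (G v a ∧ G v b) xor G a b
          ≡⟨ cong₂ (λ x y → (x ∧ G v b) xor y) (trans (G-sym v a) (cross a v sa sv)) (cross a b sa sb) ⟩
        ((A′ a ∧ B′ v) ∧ G v b) xor (A′ a ∧ B′ b)
          ≡⟨ cong (_xor (A′ a ∧ B′ b)) (∧-assoc (A′ a) (B′ v) (G v b)) ⟩
        (A′ a ∧ (B′ v ∧ G v b)) xor (A′ a ∧ B′ b)
          ≡⟨ ∧-distribˡ-xor (A′ a) (B′ v ∧ G v b) (B′ b) ⟨
        A′ a ∧ ((B′ v ∧ G v b) xor B′ b)
          ∎
        where open ≡-Reasoning

IsSplit-resp : ∀ {G H : Graph n} {s} → G ≗G H → IsSplit G s → IsSplit H s
IsSplit-resp G≗H (two-true , two-false , complete) =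
  two-true , two-false , λ a b sa sb (b′ , sb′ , ab′) (a′ , sa′ , a′b) →
    trans (sym (G≗H a b))
          (complete a b sa sb (b′ , sb′ , trans (G≗H a b′) ab′) (a′ , sa′ , trans (G≗H a′ b) a′b))

IsSplit-lc : ∀ {G : Graph n} {s} → IsSymmetric G → (v : Fin n) → IsSplit G s → IsSplit (lc v G) s
IsSplit-lc G-sym v (two-true , two-false , complete) =
  two-true , two-false ,
  completeAcross-of-biclique (biclique-lc (biclique-of-completeAcross complete) G-sym v)

IsSplit-LCStep : ∀ {G H : Graph n} → IsSimple G → LCStep G H → ∀ s → IsSplit G s ⇔ IsSplit H s
IsSplit-LCStep (G-sym , irrefl) (v , lcG≗H) s = mk⇔
  (IsSplit-resp lcG≗H ∘ IsSplit-lc G-sym v)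
  (IsSplit-resp (lc-involutive (irrefl v)) ∘ IsSplit-lc (lc-symmetric G-sym) v ∘
   IsSplit-resp (λ x y → sym (lcG≗H x y)))

IsStrongSplit-⇔ : ∀ {G H : Graph n} → (∀ s → IsSplit G s ⇔ IsSplit H s) →
                  ∀ s → IsStrongSplit G s ⇔ IsStrongSplit H s
IsStrongSplit-⇔ split⇔ s = mk⇔
  (λ (split , uncrossed) → Equivalence.to (split⇔ s) split ,
                           λ t → uncrossed t ∘ Equivalence.from (split⇔ t))
  (λ (split , uncrossed) → Equivalence.from (split⇔ s) split ,
                           λ t → uncrossed t ∘ Equivalence.to (split⇔ t))

IsNode-resp : ∀ {G H : Graph n} {p : Fin n → Fin k} →
              (∀ s → IsStrongSplit G s ⇔ IsStrongSplit H s) → IsNode G k p → IsNode H k p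
IsNode-resp strong⇔ (three , onto , parts , separated) =
  three , onto ,
  (λ i → map₂ (Equivalence.to (strong⇔ _)) (parts i)) ,
  (λ s → separated s ∘ Equivalence.from (strong⇔ s))

completeAcross-singleton : ∀ {G : Graph n} {s} → (∀ x y → s x ≡ true → s y ≡ true → x ≡ y) →
                           CompleteAcross G s
completeAcross-singleton {G = G} single a b sa _ _ (a′ , sa′ , a′b) =
  subst (λ x → G x b ≡ true) (single a′ a sa′ sa) a′b

IsNode-biclique : ∀ {G : Graph n} {p : Fin n → Fin k} → IsNode G k p → ∀ i → Biclique G (Part p i)
IsNode-biclique {G = G} {p = p} (_ , _ , parts , _) i =
  biclique-of-completeAcross ([ singleton , proj₂ ∘ proj₂ ∘ proj₁ ] (parts i))
  where
  singleton : (∀ x y → p x ≡ i → p y ≡ i → x ≡ y) → CompleteAcross G (Part p i)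
  singleton single = completeAcross-singleton λ x y px py →
    single x y (⌊⌋-true⁻ (p x ≟ i) px) (⌊⌋-true⁻ (p y ≟ i) py)

module _ {G : Graph n} (p : Fin n → Fin k) where

  Quotient-true⁺ : ∀ {i j x y} → i ≢ j → p x ≡ i → p y ≡ j → G x y ≡ true → Quotient G p i j ≡ true
  Quotient-true⁺ {i} {j} {x} {y} i≢j px py xy =
    cong₂ _∧_ (cong not (⌊⌋-false (i ≟ j) i≢j))
              (anyFin⁺ _ x (anyFin⁺ _ y
                (cong₂ _∧_ (⌊⌋-true (p x ≟ i) px) (cong₂ _∧_ (⌊⌋-true (p y ≟ j) py) xy))))

  Quotient-true⁻ : ∀ {i j} → Quotient G p i j ≡ true →
                   i ≢ j × ∃[ x ] ∃[ y ] (p x ≡ i × p y ≡ j × G x y ≡ true)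
  Quotient-true⁻ {i} {j} e with anyFin⁻ _ (∧-conicalʳ (not ⌊ i ≟ j ⌋) _ e)
  ... | x , ex with anyFin⁻ _ ex
  ...   | y , exy with ∧-conicalˡ (Part p i x) _ exy | ∧-conicalʳ (Part p i x) _ exy
  ...     | x∈i | e′ =
    (λ i≡j → true≢false (trans (sym (⌊⌋-true (i ≟ j) i≡j)) (not-true (∧-conicalˡ _ _ e)))) ,
    x , y , ⌊⌋-true⁻ (p x ≟ i) x∈i , ⌊⌋-true⁻ (p y ≟ j) (∧-conicalˡ (Part p j y) _ e′) ,
    ∧-conicalʳ (Part p j y) _ e′

  Quotient-false⁺ : ∀ {i j} → (∀ x y → p x ≡ i → p y ≡ j → G x y ≡ false) → Quotient G p i j ≡ false
  Quotient-false⁺ none = ¬-not λ e →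
    let (_ , x , y , px , py , xy) = Quotient-true⁻ e in true≢false (trans (sym xy) (none x y px py))

  Quotient-false⁻ : ∀ {i j x y} → Quotient G p i j ≡ false → i ≢ j → p x ≡ i → p y ≡ j → G x y ≡ false
  Quotient-false⁻ q i≢j px py = ¬-not λ xy → true≢false (trans (sym (Quotient-true⁺ i≢j px py xy)) q)

  Quotient-diag : ∀ i → Quotient G p i i ≡ false
  Quotient-diag i with i ≟ i
  ... | yes _   = refl
  ... | no i≢i = contradiction refl i≢i

  Quotient-symmetric : IsSymmetric G → IsSymmetric (Quotient G p)
  Quotient-symmetric G-sym i j = bool-ext swap swap
    where
    swap : ∀ {i j} → Quotient G p i j ≡ true → Quotient G p j i ≡ true
    swap e with Quotient-true⁻ e
    ... | i≢j , x , y , px , py , xy = Quotient-true⁺ (i≢j ∘ sym) py px (trans (G-sym y x) xy)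

  Quotient-product : ∀ {i j c} {f g : Fin n → Bool} → i ≢ j →
    (∀ x y → p x ≡ i → p y ≡ j → G x y ≡ c ∧ (f x ∧ g y)) →
    ∃[ x ] (p x ≡ i × f x ≡ true) → ∃[ y ] (p y ≡ j × g y ≡ true) → Quotient G p i j ≡ c
  Quotient-product {c = false} _ edges _ _ = Quotient-false⁺ edges
  Quotient-product {c = true} i≢j edges (x , px , fx) (y , py , gy) =
    Quotient-true⁺ i≢j px py (trans (edges x y px py) (cong₂ _∧_ fx gy))

Quotient-cong : ∀ {G H : Graph n} (p : Fin n → Fin k) {i j} →
  (∀ x y → p x ≡ i → p y ≡ j → G x y ≡ H x y) → Quotient G p i j ≡ Quotient H p i j
Quotient-cong p G≡H = bool-ext (transfer G≡H) (transfer λ x y px py → sym (G≡H x y px py))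
  where
  transfer : ∀ {G H : Graph _} {i j} → (∀ x y → p x ≡ i → p y ≡ j → G x y ≡ H x y) →
             Quotient G p i j ≡ true → Quotient H p i j ≡ true
  transfer G≡H e with Quotient-true⁻ p e
  ... | i≢j , x , y , px , py , xy = Quotient-true⁺ p i≢j px py (trans (sym (G≡H x y px py)) xy)

Quotient-resp : ∀ {G H : Graph n} (p : Fin n → Fin k) → G ≗G H → Quotient G p ≗G Quotient H p
Quotient-resp p G≗H i j = Quotient-cong p λ x y _ _ → G≗H x y

module _ {G : Graph n} (p : Fin n → Fin k) (v : Fin n) where

  Quotient-lc-unchanged : ∀ {i j} → (∀ x y → p x ≡ i → p y ≡ j → G v x ≡ false ⊎ G v y ≡ false) →
                          Quotient (lc v G) p i j ≡ Quotient G p i j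
  Quotient-lc-unchanged h =
    Quotient-cong p λ x y px py → [ lc-outsideˡ {G = G} , lc-outsideʳ {G = G} ]′ (h x y px py)

  Quotient-lc-not-touching : (∀ x → p x ≢ p v → G v x ≡ false) → Quotient (lc v G) p ≗G Quotient G p
  Quotient-lc-not-touching no-outside-neighbour i j = by-cases (i ≟ j)
    where
    by-cases : Dec (i ≡ j) → Quotient (lc v G) p i j ≡ Quotient G p i j
    by-cases (yes refl) = trans (Quotient-diag p i) (sym (Quotient-diag p i))
    by-cases (no i≢j) = Quotient-lc-unchanged λ x y px py → outside (p x ≟ p v) px py
      where
      outside : ∀ {x y} → Dec (p x ≡ p v) → p x ≡ i → p y ≡ j → G v x ≡ false ⊎ G v y ≡ false
      outside {y = y} (yes x∈v) px py =
        inj₂ (no-outside-neighbour y λ y∈v → i≢j (trans (sym px) (trans x∈v (trans (sym y∈v) py))))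
      outside {x = x} (no x∉v) _ _ = inj₁ (no-outside-neighbour x x∉v)

module QuotientStep {G : Graph n} (simple : IsSimple G) (p : Fin n → Fin k)
                    (biclique : ∀ i → Biclique G (Part p i)) (v : Fin n) where

  G-sym : IsSymmetric G
  G-sym = proj₁ simple

  i₀ : Fin k
  i₀ = p v

  Touches : Fin k → Set
  Touches j = ∃[ x ] (p x ≡ j × G v x ≡ true)

  HasOutsideNeighbour : Set
  HasOutsideNeighbour = ∃[ x ] (p x ≢ i₀ × G v x ≡ true)

  module Touched {j} (v∉j : i₀ ≢ j) (touches : Touches j) where
    open Biclique (biclique j)

    -- v is outside j and has a neighbour in j, so N(v) ∩ j is the frontier A′ of j.
    edge≡ : ∀ {x y} → p x ≡ j → p y ≢ j → G x y ≡ G v x ∧ B′ y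
    edge≡ {x} {y} px py = begin
      G x y        ≡⟨ cross x y (⌊⌋-true (p x ≟ j) px) (⌊⌋-false (p y ≟ j) py) ⟩
      A′ x ∧ B′ y  ≡⟨ cong (_∧ B′ y) A′x ⟩
      G x v ∧ B′ y ≡⟨ cong (_∧ B′ y) (G-sym x v) ⟩
      G v x ∧ B′ y ∎
      where
      open ≡-Reasoning
      A′x : A′ x ≡ G x v
      A′x = let (x₀ , px₀ , vx₀) = touches in
        sym (A′-neighbourhood (biclique j) (⌊⌋-false (p v ≟ j) v∉j)
               (⌊⌋-true (p x₀ ≟ j) px₀) (trans (G-sym x₀ v) vx₀) x (⌊⌋-true (p x ≟ j) px))

    edge⁻ : ∀ {x y} → p x ≡ j → p y ≢ j → G x y ≡ true → G v x ≡ true × B′ y ≡ true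
    edge⁻ {x} {y} px py xy = ∧-conicalˡ (G v x) (B′ y) e , ∧-conicalʳ (G v x) (B′ y) e
      where
      e : G v x ∧ B′ y ≡ true
      e = trans (sym (edge≡ px py)) xy

    edge⁺ : ∀ {x y} → p x ≡ j → p y ≢ j → G v x ≡ true → B′ y ≡ true → G x y ≡ true
    edge⁺ px py vx y∈B′ = trans (edge≡ px py) (cong₂ _∧_ vx y∈B′)

  edge-between-touched-parts : ∀ {i j} → i ≢ j → i₀ ≢ i → i₀ ≢ j → Touches i → Touches j →
    ∀ {x y} → p x ≡ i → p y ≡ j → G x y ≡ Quotient G p i j ∧ (G v x ∧ G v y)
  edge-between-touched-parts {i} {j} i≢j v∉i v∉j ti tj {x} {y} px py = bool-ext to from
    where
    module I = Touched v∉i ti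
    module J = Touched v∉j tj
    j-not-i : ∀ {z} → p z ≡ j → p z ≢ i
    j-not-i pz e = i≢j (trans (sym e) pz)
    i-not-j : ∀ {z} → p z ≡ i → p z ≢ j
    i-not-j pz e = i≢j (trans (sym pz) e)
    to : G x y ≡ true → Quotient G p i j ∧ (G v x ∧ G v y) ≡ true
    to xy = cong₂ _∧_ (Quotient-true⁺ p i≢j px py xy)
                      (cong₂ _∧_ (proj₁ (I.edge⁻ px (j-not-i py) xy))
                                 (proj₁ (J.edge⁻ py (i-not-j px) (trans (G-sym y x) xy))))
    from : Quotient G p i j ∧ (G v x ∧ G v y) ≡ true → G x y ≡ true
    from e with Quotient-true⁻ p (∧-conicalˡ (Quotient G p i j) _ e)
    ... | _ , x′ , y′ , px′ , py′ , x′y′ =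
      I.edge⁺ px (j-not-i py) vx (proj₂ (I.edge⁻ px′ (j-not-i py) x′y))
      where
      vx : G v x ≡ true
      vx = ∧-conicalˡ (G v x) (G v y) (∧-conicalʳ (Quotient G p i j) _ e)
      vy : G v y ≡ true
      vy = ∧-conicalʳ (G v x) (G v y) (∧-conicalʳ (Quotient G p i j) _ e)
      x′y : G x′ y ≡ true
      x′y = trans (G-sym x′ y) (J.edge⁺ py (i-not-j px′) vy
              (proj₂ (J.edge⁻ py′ (i-not-j px′) (trans (G-sym y′ x′) x′y′))))

  Quotient-lc-between-touched : ∀ {i j} → i ≢ j → i₀ ≢ i → i₀ ≢ j → Touches i → Touches j →
                                Quotient (lc v G) p i j ≡ not (Quotient G p i j)
  Quotient-lc-between-touched {i} {j} i≢j v∉i v∉j ti tj = Quotient-product p i≢j lc-edge ti tj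
    where
    lc-edge : ∀ x y → p x ≡ i → p y ≡ j → lc v G x y ≡ not (Quotient G p i j) ∧ (G v x ∧ G v y)
    lc-edge x y px py = begin
      lc v G x y
        ≡⟨ lc-xor {G = G} (λ x≡y → i≢j (trans (sym px) (trans (cong p x≡y) py))) ⟩
      (G v x ∧ G v y) xor G x y
        ≡⟨ cong ((G v x ∧ G v y) xor_) (edge-between-touched-parts i≢j v∉i v∉j ti tj px py) ⟩
      (G v x ∧ G v y) xor (Quotient G p i j ∧ (G v x ∧ G v y))
        ≡⟨ xor-∧-absorb (G v x ∧ G v y) (Quotient G p i j) ⟩
      not (Quotient G p i j) ∧ (G v x ∧ G v y) ∎
      where open ≡-Reasoning

  touches-of-Quotient : HasOutsideNeighbour → ∀ {j} → Quotient G p i₀ j ≡ true → Touches j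
  touches-of-Quotient (x₀ , px₀ , vx₀) q with Quotient-true⁻ p q
  ... | i₀≢j , a , b , pa , pb , ab = b , pb , vb
    where
    open Biclique (biclique i₀)
    b∉i₀ : ⌊ p b ≟ i₀ ⌋ ≡ false
    b∉i₀ = ⌊⌋-false (p b ≟ i₀) λ e → i₀≢j (trans (sym e) pb)
    vb : G v b ≡ true
    vb = trans (B′-neighbourhood (biclique i₀) (⌊⌋-true (p v ≟ i₀) refl)
                  (⌊⌋-false (p x₀ ≟ i₀) px₀) vx₀ b b∉i₀)
               (∧-conicalʳ (A′ a) (B′ b)
                  (trans (sym (cross a b (⌊⌋-true (p a ≟ i₀) pa) b∉i₀)) ab))

  touches-of-Quotient-lc : HasOutsideNeighbour → ∀ {j} → Quotient (lc v G) p i₀ j ≡ true → Touches j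
  touches-of-Quotient-lc out q with Quotient-true⁻ p q
  ... | i₀≢j , a , b , pa , pb , ab with true-or-false (G v b)
  ...   | inj₁ vb = b , pb , vb
  ...   | inj₂ vb =
    touches-of-Quotient out (Quotient-true⁺ p i₀≢j pa pb (trans (sym (lc-outsideʳ {G = G} vb)) ab))

  Quotient-of-touches : ∀ {H : Graph n} → (∀ x → H v x ≡ G v x) →
                        ∀ {j} → i₀ ≢ j → Touches j → Quotient H p i₀ j ≡ true
  Quotient-of-touches H≡G i₀≢j (x , px , vx) = Quotient-true⁺ p i₀≢j refl px (trans (H≡G x) vx)

  Quotient-lc-at-i₀ : HasOutsideNeighbour → ∀ {j} → i₀ ≢ j →
                      Quotient (lc v G) p i₀ j ≡ Quotient G p i₀ j
  Quotient-lc-at-i₀ out i₀≢j =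
    bool-ext (Quotient-of-touches (λ _ → refl) i₀≢j ∘ touches-of-Quotient-lc out)
             (Quotient-of-touches lc-row i₀≢j ∘ touches-of-Quotient out)
    where
    lc-row : ∀ x → lc v G v x ≡ G v x
    lc-row _ = lc-outsideˡ {G = G} (proj₂ simple v)

  Quotient-lc-touching : HasOutsideNeighbour → Quotient (lc v G) p ≗G lc i₀ (Quotient G p)
  Quotient-lc-touching out i j = by-cases i j (i ≟ j) (i₀ ≟ i) (i₀ ≟ j)
    where
    open ≡-Reasoning
    Q : Graph k
    Q = Quotient G p
    untouched : ∀ {j x} → Q i₀ j ≡ false → i₀ ≢ j → p x ≡ j → G v x ≡ false
    untouched q i₀≢j px = Quotient-false⁻ p q i₀≢j refl px
    by-cases : ∀ i j → Dec (i ≡ j) → Dec (i₀ ≡ i) → Dec (i₀ ≡ j) →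
               Quotient (lc v G) p i j ≡ lc i₀ Q i j
    by-cases i _ (yes refl) _ _ =
      trans (Quotient-diag p i) (sym (trans (lc-diag {G = Q} {i₀} i) (Quotient-diag p i)))
    by-cases _ j (no i≢j) (yes refl) _ =
      trans (Quotient-lc-at-i₀ out i≢j) (sym (lc-outsideˡ {G = Q} (Quotient-diag p i₀)))
    by-cases i _ (no i≢j) (no _) (yes refl) = begin
      Quotient (lc v G) p i i₀ ≡⟨ Quotient-symmetric p (lc-symmetric G-sym) i i₀ ⟩
      Quotient (lc v G) p i₀ i ≡⟨ Quotient-lc-at-i₀ out (i≢j ∘ sym) ⟩
      Q i₀ i                   ≡⟨ Quotient-symmetric p G-sym i₀ i ⟩
      Q i i₀                   ≡⟨ lc-outsideʳ {G = Q} (Quotient-diag p i₀) ⟨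
      lc i₀ Q i i₀             ∎
    by-cases i j (no i≢j) (no v∉i) (no v∉j) with true-or-false (Q i₀ i) | true-or-false (Q i₀ j)
    ... | inj₁ ti | inj₁ tj = begin
      Quotient (lc v G) p i j   ≡⟨ Quotient-lc-between-touched i≢j v∉i v∉j
                                     (touches-of-Quotient out ti) (touches-of-Quotient out tj) ⟩
      not (Q i j)               ≡⟨ cong₂ (λ a b → (a ∧ b) xor Q i j) ti tj ⟨
      (Q i₀ i ∧ Q i₀ j) xor Q i j ≡⟨ lc-xor {G = Q} {i₀} i≢j ⟨
      lc i₀ Q i j               ∎
    ... | inj₂ ui | _ = trans (Quotient-lc-unchanged p v λ _ _ px _ → inj₁ (untouched ui v∉i px))
                              (sym (lc-outsideˡ {G = Q} ui))
    ... | inj₁ _ | inj₂ uj = trans (Quotient-lc-unchanged p v λ _ _ _ py → inj₂ (untouched uj v∉j py))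
                                   (sym (lc-outsideʳ {G = Q} uj))

-- LCEq has no identity step up to ≗G, so equal graphs are related by complementing twice
-- at the same vertex.
LCEq-of-≗G : {X Y : Graph k} (u : Fin k) → X u u ≡ false → X ≗G Y → LCEq X Y
LCEq-of-≗G {X = X} u uu X≗Y =
  (u , λ _ _ → refl) ◅ (u , λ x y → trans (lc-involutive {G = X} uu x y) (X≗Y x y)) ◅ ε

Quotient-LCStep : ∀ {G H : Graph n} {p : Fin n → Fin k} → IsSimple G →
                  (∀ i → Biclique G (Part p i)) → LCStep G H → LCEq (Quotient G p) (Quotient H p)
Quotient-LCStep {G = G} {p = p} simple biclique (v , lcG≗H)
  with any? (λ x → ¬? (p x ≟ p v) ×-dec (G v x ≟ᵇ true))
... | yes out =
  (p v , λ i j → trans (sym (Quotient-lc-touching out i j)) (Quotient-resp p lcG≗H i j)) ◅ ε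
  where open QuotientStep simple p biclique v
... | no ¬out = LCEq-of-≗G (p v) (Quotient-diag p (p v)) λ i j →
  trans (sym (Quotient-lc-not-touching p v (λ x px → ¬-not λ vx → ¬out (x , px , vx)) i j))
        (Quotient-resp p lcG≗H i j)

LCStep⇒QASST : ∀ {G H : Graph n} → IsSimple G → LCStep G H → QASST G H
LCStep⇒QASST simple step =
  IsStrongSplit-⇔ (IsSplit-LCStep simple step) ,
  λ _ _ node → Quotient-LCStep simple (IsNode-biclique node) step

QASST-refl : ∀ {G : Graph n} → QASST G G
QASST-refl = (λ _ → ⇔-refl) , λ _ _ _ → ε

QASST-trans : ∀ {G H K : Graph n} → QASST G H → QASST H K → QASST G K
QASST-trans (strong₁ , quotients₁) (strong₂ , quotients₂) =
  (λ s → ⇔-trans (strong₁ s) (strong₂ s)) ,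
  λ k p node → quotients₁ k p node ◅◅ quotients₂ k p (IsNode-resp strong₁ node)

LCEq⇒QASST : ∀ {G H : Graph n} → IsSimple G → LCEq G H → QASST G H
LCEq⇒QASST _      ε              = QASST-refl
LCEq⇒QASST simple (step ◅ steps) =
  QASST-trans (LCStep⇒QASST simple step) (LCEq⇒QASST (IsSimple-LCStep simple step) steps)

corollary2 : ∀ {n : ℕ} (G : Graph n) → IsSimple G → OrbitLeQASST G
corollary2 G simple =
  (λ (H , simpleH , G~H) → H , simpleH , LCEq⇒QASST simple G~H) ,
  (λ _ _ H≗H′ → H≗H′) ,
  (λ _ _ H≗H′ → H≗H′)
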